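{- $\mathsf{ICK}\subseteq\mathsf{IntCK}$. However, the extension is non-conservative: the formula $\neg\neg(\top\mathbin{\Box\!\!\to}\bot)\to(\top\mathbin{\Box\!\!\to}\bot)$ belongs to $\mathsf{IntCK}\cap\mathcal{L}_{\Box}$ but not to $\mathsf{ICK}$.
   Context: $\mathcal{L}$ is built from propositional variables and $\top,\bot$ by $\wedge,\vee,\to$ and connectives $\phi\mathbin{\Box\!\!\to}\psi$, $\phi\mathbin{\Diamond\!\!\to}\psi$; $\neg\phi:=\phi\to\bot$; $\mathcal{L}_{\Box}$ is the fragment without $\mathbin{\Diamond\!\!\to}$. $\mathsf{IntCK}$ is the set of theorems of the Hilbert system with axioms: (A0) all $\mathcal{L}$-instances of a complete axiomatization of intuitionistic propositional logic; (A1) $((\phi\mathbin{\Box\!\!\to}\psi)\wedge(\phi\mathbin{\Box\!\!\to}\chi))\leftrightarrow(\phi\mathbin{\Box\!\!\to}(\psi\wedge\chi))$; (A2) $((\phi\mathbin{\Diamond\!\!\to}\psi)\wedge(\phi\mathbin{\Box\!\!\to}\chi))\to(\phi\mathbin{\Diamond\!\!\to}(\psi\wedge\chi))$; (A3) $(\phi\mathbin{\Diamond\!\!\to}(\psi\vee\chi))\leftrightarrow((\phi\mathbin{\Diamond\!\!\to}\psi)\vee(\phi\mathbin{\Diamond\!\!\to}\chi))$; (A4) $((\phi\mathbin{\Diamond\!\!\to}\psi)\to(\phi\mathbin{\Box\!\!\to}\chi))\to(\phi\mathbin{\Box\!\!\to}(\psi\to\chi))$; (A5) $\phi\mathbin{\Box\!\!\to}\top$;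 (A6) $\neg(\phi\mathbin{\Diamond\!\!\to}\bot)$; rules: modus ponens; from $\phi\leftrightarrow\psi$ infer $(\phi\mathbin{\Box\!\!\to}\chi)\leftrightarrow(\psi\mathbin{\Box\!\!\to}\chi)$ and $(\chi\mathbin{\Box\!\!\to}\phi)\leftrightarrow(\chi\mathbin{\Box\!\!\to}\psi)$; and the same two rules with $\mathbin{\Diamond\!\!\to}$ (equivalently, $\mathsf{IntCK}$ is the set of formulas valid in all Chellas models). $\mathsf{ICK}$ (Weiss's intuitionistic conditional logic) is the set of $\mathcal{L}_{\Box}$-formulas provable from (A0) (instances in $\mathcal{L}_{\Box}$), (A1), (A5) by modus ponens and the two $\mathbin{\Box\!\!\to}$-rules above. -}

module Defs where

open import Data.Bool using (Bool; true; false)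
open import Data.Nat using (ℕ)
open import Data.Product using (_×_)

-- Formulas. Fm true = the full language L; Fm false = the fragment L_□
-- (no ◇→ connective).
infixr 5 _⇒_
infixr 6 _∨′_
infixr 7 _∧′_
infix 8 _□→_ _◇→_

data Fm : Bool → Set where
  var   : ∀ {b} → ℕ → Fm b
  ⊤′ ⊥′ : ∀ {b} → Fm b
  _∧′_ _∨′_ _⇒_ : ∀ {b} → Fm b → Fm b → Fm b
  _□→_  : ∀ {b} → Fm b → Fm b → Fm b
  _◇→_  : Fm true → Fm true → Fm true

L : Set
L = Fm true

L□ : Set
L□ = Fm false

¬′_ : ∀ {b} → Fm b → Fm b
¬′ φ = φ ⇒ ⊥′

infix 4 _⇔_
_⇔_ : ∀ {b} → Fm b → Fm b → Fm b
φ ⇔ ψ = (φ ⇒ ψ) ∧′ (ψ ⇒ φ)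

embed : L□ → L
embed (var x) = var x
embed ⊤′ = ⊤′
embed ⊥′ = ⊥′
embed (φ ∧′ ψ) = embed φ ∧′ embed ψ
embed (φ ∨′ ψ) = embed φ ∨′ embed ψ
embed (φ ⇒ ψ) = embed φ ⇒ embed ψ
embed (φ □→ ψ) = embed φ □→ embed ψ

-- (A0): a fixed complete Hilbert axiomatization of intuitionistic
-- propositional logic, instantiated with formulas of Fm b.
data IPCAx {b : Bool} : Fm b → Set where
  ax-K   : ∀ φ ψ → IPCAx (φ ⇒ ψ ⇒ φ)
  ax-S   : ∀ φ ψ χ → IPCAx ((φ ⇒ ψ ⇒ χ) ⇒ (φ ⇒ ψ) ⇒ φ ⇒ χ)
  ax-∧E₁ : ∀ φ ψ → IPCAx (φ ∧′ ψ ⇒ φ)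
  ax-∧E₂ : ∀ φ ψ → IPCAx (φ ∧′ ψ ⇒ ψ)
  ax-∧I  : ∀ φ ψ → IPCAx (φ ⇒ ψ ⇒ φ ∧′ ψ)
  ax-∨I₁ : ∀ φ ψ → IPCAx (φ ⇒ φ ∨′ ψ)
  ax-∨I₂ : ∀ φ ψ → IPCAx (ψ ⇒ φ ∨′ ψ)
  ax-∨E  : ∀ φ ψ χ → IPCAx ((φ ⇒ χ) ⇒ (ψ ⇒ χ) ⇒ φ ∨′ ψ ⇒ χ)
  ax-⊥E  : ∀ φ → IPCAx (⊥′ ⇒ φ)
  ax-⊤   : IPCAx ⊤′

data IntCK : L → Set where
  A0  : ∀ {φ} → IPCAx φ → IntCK φ
  A1  : ∀ φ ψ χ → IntCK (((φ □→ ψ) ∧′ (φ □→ χ)) ⇔ (φ □→ (ψ ∧′ χ)))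
  A2  : ∀ φ ψ χ → IntCK (((φ ◇→ ψ) ∧′ (φ □→ χ)) ⇒ (φ ◇→ (ψ ∧′ χ)))
  A3  : ∀ φ ψ χ → IntCK ((φ ◇→ (ψ ∨′ χ)) ⇔ ((φ ◇→ ψ) ∨′ (φ ◇→ χ)))
  A4  : ∀ φ ψ χ → IntCK (((φ ◇→ ψ) ⇒ (φ □→ χ)) ⇒ (φ □→ (ψ ⇒ χ)))
  A5  : ∀ φ → IntCK (φ □→ ⊤′)
  A6  : ∀ φ → IntCK (¬′ (φ ◇→ ⊥′))
  MP  : ∀ {φ ψ} → IntCK (φ ⇒ ψ) → IntCK φ → IntCK ψ
  RA□ : ∀ {φ ψ} χ → IntCK (φ ⇔ ψ) → IntCK ((φ □→ χ) ⇔ (ψ □→ χ))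
  RC□ : ∀ {φ ψ} χ → IntCK (φ ⇔ ψ) → IntCK ((χ □→ φ) ⇔ (χ □→ ψ))
  RA◇ : ∀ {φ ψ} χ → IntCK (φ ⇔ ψ) → IntCK ((φ ◇→ χ) ⇔ (ψ ◇→ χ))
  RC◇ : ∀ {φ ψ} χ → IntCK (φ ⇔ ψ) → IntCK ((χ ◇→ φ) ⇔ (χ ◇→ ψ))

data ICK : L□ → Set where
  A0  : ∀ {φ} → IPCAx φ → ICK φ
  A1  : ∀ φ ψ χ → ICK (((φ □→ ψ) ∧′ (φ □→ χ)) ⇔ (φ □→ (ψ ∧′ χ)))
  A5  : ∀ φ → ICK (φ □→ ⊤′)
  MP  : ∀ {φ ψ} → ICK (φ ⇒ ψ) → ICK φ → ICK ψ
  RA□ : ∀ {φ ψ} χ → ICK (φ ⇔ ψ) → ICK ((φ □→ χ) ⇔ (ψ □→ χ))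
  RC□ : ∀ {φ ψ} χ → ICK (φ ⇔ ψ) → ICK ((χ □→ φ) ⇔ (χ □→ ψ))

witness : L□
witness = ¬′ ¬′ (⊤′ □→ ⊥′) ⇒ (⊤′ □→ ⊥′)

{-# OPTIONS --safe #-}
-- In IntCK, φ ◇→ ⊤ refutes φ □→ ⊥ (A2 and A6), while A4 turns
-- "φ ◇→ ⊤ implies φ □→ ⊥" into φ □→ (⊤ → ⊥); together these give
-- ¬¬(φ □→ ⊥) → (φ □→ ⊥). ICK, on the other hand, is sound for Heyting
-- algebras in which φ □→ ψ is read as k ∨ ψ for a fixed element k. In the
-- three-element chain with k the middle element, ¬¬k is the top but k is
-- not, so the witness is refuted.
module Submission where

open import Defs
open import Algebra.Core using (Op₂)
import Algebra.Construct.NaturalChoice.Max as Max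
import Algebra.Construct.NaturalChoice.Min as Min
open import Data.Fin using (zero; suc)
import Data.Fin.Properties as Fin
open import Data.List using (List; []; _∷_)
open import Data.List.Membership.Propositional using (_∈_)
open import Data.List.Relation.Unary.Any using (here; there)
open import Data.Nat using (ℕ; z≤n)
open import Data.Nat.Properties using (1+n≰n)
open import Data.Product using (_×_; _,_)
open import Data.Sum using (inj₁; inj₂)
open import Relation.Binary.Bundles using (DecTotalOrder)
open import Relation.Binary.Core using (_Preserves₂_⟶_⟶_)
open import Relation.Binary.Definitions using (Maximum; Minimum)
open import Relation.Binary.Lattice using (HeytingAlgebra)
import Relation.Binary.Lattice.Properties.BoundedLattice as BoundedLatticeProperties
import Relation.Binary.Lattice.Properties.DistributiveLattice as DistributiveLatticeProperties
import Relation.Binary.Lattice.Properties.HeytingAlgebra as HeytingAlgebraProperties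
import Relation.Binary.Lattice.Properties.JoinSemilattice as JoinSemilatticeProperties
import Relation.Binary.Lattice.Properties.MeetSemilattice as MeetSemilatticeProperties
open import Relation.Binary.PropositionalEquality using (refl)
open import Relation.Nullary using (¬_; yes; no; contradiction)

embed-IPCAx : {φ : L□} → IPCAx φ → IPCAx (embed φ)
embed-IPCAx (ax-K φ ψ)     = ax-K (embed φ) (embed ψ)
embed-IPCAx (ax-S φ ψ χ)   = ax-S (embed φ) (embed ψ) (embed χ)
embed-IPCAx (ax-∧E₁ φ ψ)   = ax-∧E₁ (embed φ) (embed ψ)
embed-IPCAx (ax-∧E₂ φ ψ)   = ax-∧E₂ (embed φ) (embed ψ)
embed-IPCAx (ax-∧I φ ψ)    = ax-∧I (embed φ) (embed ψ)
embed-IPCAx (ax-∨I₁ φ ψ)   = ax-∨I₁ (embed φ) (embed ψ)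
embed-IPCAx (ax-∨I₂ φ ψ)   = ax-∨I₂ (embed φ) (embed ψ)
embed-IPCAx (ax-∨E φ ψ χ)  = ax-∨E (embed φ) (embed ψ) (embed χ)
embed-IPCAx (ax-⊥E φ)      = ax-⊥E (embed φ)
embed-IPCAx ax-⊤           = ax-⊤

ICK⊆IntCK : (φ : L□) → ICK φ → IntCK (embed φ)
ICK⊆IntCK _ (A0 a)       = A0 (embed-IPCAx a)
ICK⊆IntCK _ (A1 φ ψ χ)   = A1 (embed φ) (embed ψ) (embed χ)
ICK⊆IntCK _ (A5 φ)       = A5 (embed φ)
ICK⊆IntCK _ (MP d e)     = MP (ICK⊆IntCK _ d) (ICK⊆IntCK _ e)
ICK⊆IntCK _ (RA□ χ d)    = RA□ (embed χ) (ICK⊆IntCK _ d)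
ICK⊆IntCK _ (RC□ χ d)    = RC□ (embed χ) (ICK⊆IntCK _ d)

infix 2 _⊢_

data _⊢_ (Γ : List L) : L → Set where
  thm : ∀ {φ} → IntCK φ → Γ ⊢ φ
  hyp : ∀ {φ} → φ ∈ Γ → Γ ⊢ φ
  mp  : ∀ {φ ψ} → Γ ⊢ φ ⇒ ψ → Γ ⊢ φ → Γ ⊢ ψ

axiom : ∀ {Γ φ} → IPCAx φ → Γ ⊢ φ
axiom a = thm (A0 a)

⊢-closed : ∀ {φ} → [] ⊢ φ → IntCK φ
⊢-closed (thm t)  = t
⊢-closed (hyp ())
⊢-closed (mp d e) = MP (⊢-closed d) (⊢-closed e)

⇒-refl : ∀ {Γ} φ → Γ ⊢ φ ⇒ φ
⇒-refl φ = mp (mp (axiom (ax-S φ (φ ⇒ φ) φ)) (axiom (ax-K φ (φ ⇒ φ)))) (axiom (ax-K φ φ))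

deduction : ∀ {Γ φ ψ} → φ ∷ Γ ⊢ ψ → Γ ⊢ φ ⇒ ψ
deduction {φ = φ} (thm t)            = mp (axiom (ax-K _ φ)) (thm t)
deduction {φ = φ} (hyp (here refl))  = ⇒-refl φ
deduction {φ = φ} (hyp (there h))    = mp (axiom (ax-K _ φ)) (hyp h)
deduction {φ = φ} (mp d e)           = mp (mp (axiom (ax-S φ _ _)) (deduction d)) (deduction e)

∧-intro : ∀ {Γ φ ψ} → Γ ⊢ φ → Γ ⊢ ψ → Γ ⊢ φ ∧′ ψ
∧-intro d e = mp (mp (axiom (ax-∧I _ _)) d) e

⇔-elim : ∀ {Γ φ ψ} → Γ ⊢ φ ⇔ ψ → Γ ⊢ φ → Γ ⊢ ψ
⇔-elim d e = mp (mp (axiom (ax-∧E₁ _ _)) d) e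

⊥-elim : ∀ {Γ φ} → Γ ⊢ ⊥′ → Γ ⊢ φ
⊥-elim d = mp (axiom (ax-⊥E _)) d

∧⊥⇔⊥ : ∀ φ → IntCK (φ ∧′ ⊥′ ⇔ ⊥′)
∧⊥⇔⊥ φ = ⊢-closed (∧-intro (axiom (ax-∧E₂ φ ⊥′)) (axiom (ax-⊥E _)))

⊤⇒⊥⇔⊥ : IntCK ((⊤′ ⇒ ⊥′) ⇔ ⊥′)
⊤⇒⊥⇔⊥ = ⊢-closed (∧-intro (deduction (mp (hyp (here refl)) (axiom ax-⊤))) (axiom (ax-⊥E _)))

◇→⇒¬□→⊥ : ∀ φ ψ → IntCK ((φ ◇→ ψ) ⇒ ¬′ (φ □→ ⊥′))
◇→⇒¬□→⊥ φ ψ = ⊢-closed (deduction (deduction (mp (thm (A6 φ))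
  (⇔-elim (thm (RC◇ φ (∧⊥⇔⊥ ψ)))
    (mp (thm (A2 φ ψ ⊥′)) (∧-intro (hyp (there (here refl))) (hyp (here refl))))))))

[◇→⊤⇒□→⊥]⇒□→⊥ : ∀ φ → IntCK (((φ ◇→ ⊤′) ⇒ (φ □→ ⊥′)) ⇒ (φ □→ ⊥′))
[◇→⊤⇒□→⊥]⇒□→⊥ φ = ⊢-closed (deduction
  (⇔-elim (thm (RC□ φ ⊤⇒⊥⇔⊥)) (mp (thm (A4 φ ⊤′ ⊥′)) (hyp (here refl)))))

¬¬□→⊥⇒□→⊥ : ∀ φ → IntCK (¬′ ¬′ (φ □→ ⊥′) ⇒ (φ □→ ⊥′))
¬¬□→⊥⇒□→⊥ φ = ⊢-closed (deduction (mp (thm ([◇→⊤⇒□→⊥]⇒□→⊥ φ)) (deduction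
  (⊥-elim (mp (hyp (there (here refl))) (mp (thm (◇→⇒¬□→⊥ φ ⊤′)) (hyp (here refl))))))))

module HeytingSemantics {c ℓ₁ ℓ₂} (𝓗 : HeytingAlgebra c ℓ₁ ℓ₂) where
  open HeytingAlgebra 𝓗 renaming (refl to ≤-refl)
  open HeytingAlgebraProperties 𝓗 using (y≤x⇨y; ⇨-eval; ⇨-distribˡ-∨-∧-≥; distributiveLattice)
  open DistributiveLatticeProperties distributiveLattice using (∨-distribˡ-∧)
  open BoundedLatticeProperties boundedLattice using (∨-zeroʳ)
  open JoinSemilatticeProperties joinSemilattice using (∨-cong)
  open MeetSemilatticeProperties meetSemilattice using (∧-monotonic)

  ⊤≤⇨⇒≤ : ∀ {x y} → ⊤ ≤ x ⇨ y → x ≤ y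
  ⊤≤⇨⇒≤ {x} ⊤≤x⇨y = trans (∧-greatest (maximum x) ≤-refl) (transpose-∧ ⊤≤x⇨y)

  ≤⇒⊤≤⇨ : ∀ {x y} → x ≤ y → ⊤ ≤ x ⇨ y
  ≤⇒⊤≤⇨ x≤y = transpose-⇨ (trans (x∧y≤y _ _) x≤y)

  ≈⇒⊤≤⇔ : ∀ {x y} → x ≈ y → ⊤ ≤ (x ⇨ y) ∧ (y ⇨ x)
  ≈⇒⊤≤⇔ x≈y = ∧-greatest (≤⇒⊤≤⇨ (reflexive x≈y)) (≤⇒⊤≤⇨ (reflexive (Eq.sym x≈y)))

  ⊤≤⇔⇒≈ : ∀ {x y} → ⊤ ≤ (x ⇨ y) ∧ (y ⇨ x) → x ≈ y
  ⊤≤⇔⇒≈ ⊤≤x⇔y = antisym (⊤≤⇨⇒≤ (trans ⊤≤x⇔y (x∧y≤x _ _))) (⊤≤⇨⇒≤ (trans ⊤≤x⇔y (x∧y≤y _ _)))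

  ⇨-S : ∀ {x y z} → x ⇨ y ⇨ z ≤ (x ⇨ y) ⇨ x ⇨ z
  ⇨-S = transpose-⇨ (transpose-⇨ (trans
    (∧-greatest (trans (∧-monotonic (x∧y≤x _ _) ≤-refl) ⇨-eval)
                (trans (∧-monotonic (x∧y≤y _ _) ≤-refl) ⇨-eval))
    ⇨-eval))

  module _ (_▷_ : Op₂ Carrier) (ρ : ℕ → Carrier) where

    ⟦_⟧ : L□ → Carrier
    ⟦ var n ⟧   = ρ n
    ⟦ ⊤′ ⟧      = ⊤
    ⟦ ⊥′ ⟧      = ⊥
    ⟦ φ ∧′ ψ ⟧  = ⟦ φ ⟧ ∧ ⟦ ψ ⟧
    ⟦ φ ∨′ ψ ⟧  = ⟦ φ ⟧ ∨ ⟦ ψ ⟧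
    ⟦ φ ⇒ ψ ⟧   = ⟦ φ ⟧ ⇨ ⟦ ψ ⟧
    ⟦ φ □→ ψ ⟧  = ⟦ φ ⟧ ▷ ⟦ ψ ⟧

    IPCAx-valid : ∀ {φ} → IPCAx φ → ⊤ ≤ ⟦ φ ⟧
    IPCAx-valid (ax-K φ ψ)     = ≤⇒⊤≤⇨ y≤x⇨y
    IPCAx-valid (ax-S φ ψ χ)   = ≤⇒⊤≤⇨ ⇨-S
    IPCAx-valid (ax-∧E₁ φ ψ)   = ≤⇒⊤≤⇨ (x∧y≤x _ _)
    IPCAx-valid (ax-∧E₂ φ ψ)   = ≤⇒⊤≤⇨ (x∧y≤y _ _)
    IPCAx-valid (ax-∧I φ ψ)    = ≤⇒⊤≤⇨ (transpose-⇨ ≤-refl)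
    IPCAx-valid (ax-∨I₁ φ ψ)   = ≤⇒⊤≤⇨ (x≤x∨y _ _)
    IPCAx-valid (ax-∨I₂ φ ψ)   = ≤⇒⊤≤⇨ (y≤x∨y _ _)
    IPCAx-valid (ax-∨E φ ψ χ)  = ≤⇒⊤≤⇨ (transpose-⇨ (⇨-distribˡ-∨-∧-≥ _ _ _))
    IPCAx-valid (ax-⊥E φ)      = ≤⇒⊤≤⇨ (minimum _)
    IPCAx-valid ax-⊤           = ≤-refl

    ICK-sound : _▷_ Preserves₂ _≈_ ⟶ _≈_ ⟶ _≈_ →
                (∀ x → x ▷ ⊤ ≈ ⊤) →
                (∀ x y z → (x ▷ y) ∧ (x ▷ z) ≈ x ▷ (y ∧ z)) →
                ∀ {φ} → ICK φ → ⊤ ≤ ⟦ φ ⟧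
    ICK-sound ▷-cong ▷-⊤ ▷-∧ = sound
      where
      sound : ∀ {φ} → ICK φ → ⊤ ≤ ⟦ φ ⟧
      sound (A0 a)      = IPCAx-valid a
      sound (A1 φ ψ χ)  = ≈⇒⊤≤⇔ (▷-∧ ⟦ φ ⟧ ⟦ ψ ⟧ ⟦ χ ⟧)
      sound (A5 φ)      = reflexive (Eq.sym (▷-⊤ ⟦ φ ⟧))
      sound (MP d e)    = trans (sound e) (⊤≤⇨⇒≤ (sound d))
      sound (RA□ χ d)   = ≈⇒⊤≤⇔ (▷-cong (⊤≤⇔⇒≈ (sound d)) Eq.refl)
      sound (RC□ χ d)   = ≈⇒⊤≤⇔ (▷-cong Eq.refl (⊤≤⇔⇒≈ (sound d)))

  join-with : Carrier → Op₂ Carrier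
  join-with k _ y = k ∨ y

  join-with-sound : ∀ k ρ {φ} → ICK φ → ⊤ ≤ ⟦ join-with k ⟧ ρ φ
  join-with-sound k ρ = ICK-sound (join-with k) ρ
    (λ _ y≈y′ → ∨-cong Eq.refl y≈y′) (λ _ → ∨-zeroʳ k) (λ _ y z → Eq.sym (∨-distribˡ-∧ k y z))

module _ {a ℓ₁ ℓ₂} (O : DecTotalOrder a ℓ₁ ℓ₂) where
  open DecTotalOrder O renaming (Carrier to A)
  open Min totalOrder using (_⊓_; x⊓y≤x; x⊓y≤y; ⊓-glb; ⊓-sel)
  open Max totalOrder using (_⊔_; x≤x⊔y; x≤y⊔x; ⊔-lub)

  boundedChain-heytingAlgebra : ∀ {⊤ ⊥} → Maximum _≤_ ⊤ → Minimum _≤_ ⊥ → HeytingAlgebra a ℓ₁ ℓ₂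
  boundedChain-heytingAlgebra {⊤} max min = record
    { _⇨_              = _⇨_
    ; isHeytingAlgebra = record
      { isBoundedLattice = record
        { isLattice = record
          { isPartialOrder = isPartialOrder
          ; supremum       = λ x y → x≤x⊔y x y , x≤y⊔x x y , λ _ → ⊔-lub
          ; infimum        = λ x y → x⊓y≤x x y , x⊓y≤y x y , λ _ → ⊓-glb
          }
        ; maximum = max
        ; minimum = min
        }
      ; exponential = exponential
      }
    }
    where
    _⇨_ : Op₂ A
    x ⇨ y with x ≤? y
    ... | yes _ = ⊤
    ... | no  _ = y

    exponential : ∀ w x y → (w ⊓ x ≤ y → w ≤ x ⇨ y) × (w ≤ x ⇨ y → w ⊓ x ≤ y)
    exponential w x y with x ≤? y
    ... | yes x≤y = (λ _ → max w) , (λ _ → trans (x⊓y≤y w x) x≤y)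
    ... | no  x≰y = ≤-below , λ w≤y → trans (x⊓y≤x w x) w≤y
      where
      ≤-below : w ⊓ x ≤ y → w ≤ y
      ≤-below w⊓x≤y with ⊓-sel w x
      ... | inj₁ w⊓x≈w = ≤-respˡ-≈ w⊓x≈w w⊓x≤y
      ... | inj₂ w⊓x≈x = contradiction (≤-respˡ-≈ w⊓x≈x w⊓x≤y) x≰y

three-chain : HeytingAlgebra _ _ _
three-chain = boundedChain-heytingAlgebra (Fin.≤-decTotalOrder 3) Fin.≤fromℕ (λ _ → z≤n)

-- With φ □→ ψ read as 1 ∨ ψ in the chain 0 < 1 < 2, the witness evaluates to
-- ¬¬1 ⇨ 1 = 2 ⇨ 1 = 1, so soundness would give 2 ≤ 1.
ICK⊬witness : ¬ ICK witness
ICK⊬witness d = 1+n≰n (HeytingSemantics.join-with-sound three-chain (suc zero) (λ _ → zero) d)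

proposition3 : ((φ : L□) → ICK φ → IntCK (embed φ))
    × (IntCK (embed witness) × ¬ ICK witness)
proposition3 = ICK⊆IntCK , ¬¬□→⊥⇒□→⊥ ⊤′ , ICK⊬witness
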